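{- Every rooted tree whose vertices and edges are labeled by positive integers is isomorphic (via an isomorphism preserving the root and all labels) to the low-defect tree of some low-defect expression.
   Context: Low-defect expressions: (a) every positive integer constant is one; (b) the product of two low-defect expressions with disjoint variable sets is one; (c) if $E$ is one, $c$ a positive integer and $x$ a variable not in $E$, then $E\cdot x+c$ is one. The low-defect tree of an expression: for a constant $n$, a single vertex labeled $n$; for $E=E'\cdot x+c$ with tree $T'$, $T'$ with a new root labeled $1$ joined to the root of $T'$ by an edge labeled $c$; for $E=E_1\cdot E_2$ with trees $T_1,T_2$, remove both roots and add a new root labeled by the product of the old root labels, adjacent to all vertices formerly adjacent to either old root, edge labels kept. -}

module Defs where

open import Data.Nat using (ℕ; _*_; _≤_)
open import Data.Product using (_×_; _,_; Σ; ∃-syntax)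
open import Data.List using (List; []; _∷_; _++_)
open import Data.List.Membership.Propositional using (_∈_; _∉_)
open import Data.List.Relation.Binary.Permutation.Propositional using (_↭_)
open import Data.List.Relation.Binary.Pointwise using (Pointwise)
open import Relation.Binary.PropositionalEquality using (_≡_)

-- A tree is its root label together with the list of (edge label, subtree)
-- pairs for the root's children.  The order of children is irrelevant:
-- it is quotiented out by the isomorphism relation _≅_ below.

data LTree : Set where
  node : ℕ → List (ℕ × LTree) → LTree

data AllPos : LTree → Set
data AllPosChildren : List (ℕ × LTree) → Set

data AllPos where
  node : ∀ {n cs} → 1 ≤ n → AllPosChildren cs → AllPos (node n cs)

data AllPosChildren where
  [] : AllPosChildren []
  _∷_ : ∀ {c t cs} → (1 ≤ c × AllPos t) → AllPosChildren cs → AllPosChildren ((c , t) ∷ cs)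

data _≅_ : LTree → LTree → Set

EdgeIso : (ℕ × LTree) → (ℕ × LTree) → Set
EdgeIso (c , s) (d , t) = (c ≡ d) × (s ≅ t)

data _≅_ where
  node : ∀ {n m cs ds} → n ≡ m →
         (Σ (List (ℕ × LTree)) λ ds′ → (ds ↭ ds′) × Pointwise EdgeIso cs ds′) →
         node n cs ≅ node m ds

Var : Set
Var = ℕ

data Expr : Set where
  const : ℕ → Expr
  _⊗_   : Expr → Expr → Expr
  lin   : Expr → Var → ℕ → Expr    -- lin E x c  represents  E · x + c

vars : Expr → List Var
vars (const n) = []
vars (e₁ ⊗ e₂) = vars e₁ ++ vars e₂
vars (lin e x c) = x ∷ vars e

Disjoint : List Var → List Var → Set
Disjoint xs ys = ∀ {x} → x ∈ xs → x ∉ ys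

data LowDefect : Expr → Set where
  const : ∀ {n} → 1 ≤ n → LowDefect (const n)
  mul   : ∀ {e₁ e₂} → LowDefect e₁ → LowDefect e₂ →
          Disjoint (vars e₁) (vars e₂) → LowDefect (e₁ ⊗ e₂)
  lin   : ∀ {e x c} → LowDefect e → 1 ≤ c → x ∉ vars e → LowDefect (lin e x c)

tree : Expr → LTree
tree (const n) = node n []
tree (lin e x c) = node 1 ((c , tree e) ∷ [])
tree (e₁ ⊗ e₂) with tree e₁ | tree e₂
... | node n₁ cs₁ | node n₂ cs₂ = node (n₁ * n₂) (cs₁ ++ cs₂)

{-# OPTIONS --safe #-}
module Submission where

open import Defs
open import Data.Product using (Σ; _×_; _,_)
open import Data.Nat using (ℕ; suc; _+_; _*_; _≤_; _<_; s≤s)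
open import Data.Nat.Properties
open import Data.List using (List; []; _∷_)
open import Data.Sum using (inj₁; inj₂)
open import Data.Empty using (⊥)
open import Data.List.Relation.Unary.Any using (here; there)
open import Data.List.Membership.Propositional using (_∈_)
open import Data.List.Membership.Propositional.Properties using (∈-++⁻)
open import Data.List.Relation.Binary.Permutation.Propositional using (prep)
  renaming (refl to ↭-refl)
open import Data.List.Relation.Binary.Pointwise using ([]; _∷_)
open import Relation.Binary.PropositionalEquality using (_≡_; refl; sym; trans)

-- A vertex labelled n with children (c₁, T₁), …, (cᵣ, Tᵣ) is the tree of
-- (E₁ · x₁ + c₁) ⋯ (Eᵣ · xᵣ + cᵣ) · n, where Eᵢ is built recursively for Tᵢ.
-- The variables are made pairwise distinct by numbering the edges: the
-- expression built for a tree from counter k uses only variables in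
-- [k, k + number of edges), and consecutive children get adjacent intervals.

InRange : ℕ → ℕ → ℕ → Set
InRange a b x = a ≤ x × x < b

InRange-widen : ∀ {a a′ b b′ x} → a′ ≤ a → b ≤ b′ → InRange a b x → InRange a′ b′ x
InRange-widen a′≤a b≤b′ (a≤x , x<b) = ≤-trans a′≤a a≤x , <-≤-trans x<b b≤b′

InRange-adjacent : ∀ {a b c x} → InRange a b x → InRange b c x → ⊥
InRange-adjacent (_ , x<b) (b≤x , _) = <-irrefl refl (<-≤-trans x<b b≤x)

suc-+-assoc : ∀ k m n → suc k + m + n ≡ k + (suc m + n)
suc-+-assoc k m n = trans (+-assoc (suc k) m n) (sym (+-suc k (m + n)))

mutual
  edges : LTree → ℕ
  edges (node _ cs) = edgesᶜ cs

  edgesᶜ : List (ℕ × LTree) → ℕ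
  edgesᶜ [] = 0
  edgesᶜ ((_ , t) ∷ cs) = suc (edges t) + edgesᶜ cs

mutual
  expr : LTree → ℕ → Expr
  expr (node n cs) k = exprᶜ n cs k

  exprᶜ : ℕ → List (ℕ × LTree) → ℕ → Expr
  exprᶜ n [] k = const n
  exprᶜ n ((c , t) ∷ cs) k = lin (expr t (suc k)) k c ⊗ exprᶜ n cs (suc k + edges t)

mutual
  vars-expr : ∀ t k {x} → x ∈ vars (expr t k) → InRange k (k + edges t) x
  vars-expr (node n cs) k = vars-exprᶜ n cs k

  vars-exprᶜ : ∀ n cs k {x} → x ∈ vars (exprᶜ n cs k) → InRange k (k + edgesᶜ cs) x
  vars-exprᶜ n [] k ()
  vars-exprᶜ n ((c , t) ∷ cs) k x∈ with ∈-++⁻ (vars (lin (expr t (suc k)) k c)) x∈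
  ... | inj₁ x∈head = InRange-widen ≤-refl child-end≤ (vars-child t k c x∈head)
    where
    child-end≤ : suc k + edges t ≤ k + edgesᶜ ((c , t) ∷ cs)
    child-end≤ = ≤-trans (m≤m+n _ (edgesᶜ cs)) (≤-reflexive (suc-+-assoc k (edges t) (edgesᶜ cs)))
  ... | inj₂ x∈tail = InRange-widen k≤start (≤-reflexive (suc-+-assoc k (edges t) (edgesᶜ cs)))
                                    (vars-exprᶜ n cs _ x∈tail)
    where
    k≤start : k ≤ suc k + edges t
    k≤start = ≤-trans (n≤1+n k) (m≤m+n (suc k) (edges t))

  vars-child : ∀ t k c {x} → x ∈ vars (lin (expr t (suc k)) k c) → InRange k (suc k + edges t) x
  vars-child t k c (here refl) = ≤-refl , s≤s (m≤m+n k (edges t))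
  vars-child t k c (there x∈) = InRange-widen (n≤1+n k) ≤-refl (vars-expr t (suc k) x∈)

mutual
  expr-lowDefect : ∀ t k → AllPos t → LowDefect (expr t k)
  expr-lowDefect (node n cs) k (node 1≤n cs⁺) = exprᶜ-lowDefect n cs k 1≤n cs⁺

  exprᶜ-lowDefect : ∀ n cs k → 1 ≤ n → AllPosChildren cs → LowDefect (exprᶜ n cs k)
  exprᶜ-lowDefect n [] k 1≤n [] = const 1≤n
  exprᶜ-lowDefect n ((c , t) ∷ cs) k 1≤n ((1≤c , t⁺) ∷ cs⁺) =
    mul (lin (expr-lowDefect t (suc k) t⁺) 1≤c k-fresh)
        (exprᶜ-lowDefect n cs (suc k + edges t) 1≤n cs⁺)
        (λ x∈head x∈tail → InRange-adjacent (vars-child t k c x∈head) (vars-exprᶜ n cs _ x∈tail))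
    where
    k-fresh : k ∈ vars (expr t (suc k)) → ⊥
    k-fresh k∈ = InRange-adjacent {k} (≤-refl , ≤-refl) (vars-expr t (suc k) k∈)

≅-cons : ∀ {n m c t t′ cs ds} → t ≅ t′ → node n cs ≅ node m ds →
         node n ((c , t) ∷ cs) ≅ node (1 * m) ((c , t′) ∷ ds)
≅-cons {m = m} t≅t′ (node n≡m (ds′ , ds↭ds′ , cs≈ds′)) =
  node (trans n≡m (sym (*-identityˡ m))) (_ , prep _ ds↭ds′ , (refl , t≅t′) ∷ cs≈ds′)

mutual
  tree-expr : ∀ t k → t ≅ tree (expr t k)
  tree-expr (node n cs) k = tree-exprᶜ n cs k

  tree-exprᶜ : ∀ n cs k → node n cs ≅ tree (exprᶜ n cs k)
  tree-exprᶜ n [] k = node refl ([] , ↭-refl , [])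
  tree-exprᶜ n ((c , t) ∷ cs) k
    with tree (exprᶜ n cs (suc k + edges t)) | tree-exprᶜ n cs (suc k + edges t)
  ... | node _ _ | rest≅ = ≅-cons (tree-expr t (suc k)) rest≅

proposition3p5 : (T : LTree) → AllPos T →
    Σ Expr (λ E → LowDefect E × (T ≅ tree E))
proposition3p5 T T⁺ = expr T 0 , expr-lowDefect T 0 T⁺ , tree-expr T 0
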